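{- Let $k\ge 2$ be an odd integer which is not prime. Every $k$-$T_0T^\ast$-perfect number $n>1$ has the form $n=p_1^{2k-1}$ or $n=p_1^{(d-1)/2}\cdot p_2^{(k/d-1)/2}$, where $p_1\ne p_2$ are primes and $d$ is a positive proper divisor of $k$ satisfying $2<d<k$.
   Context: $T(m)$ denotes the product of all positive divisors of $m$. A divisor $d$ of $m$ is unitary if $\gcd(d,m/d)=1$, and $T^\ast(m)$ denotes the product of all unitary divisors of $m$. For an integer $K\ge 2$, an integer $n>1$ is called $K$-$T_0T^\ast$-perfect if $T(T^\ast(n))=n^K$. -}

module Defs where

open import Data.Nat using (ℕ; suc; _*_; _^_)
open import Data.Nat.Divisibility using (_∣?_)
open import Data.Nat.GCD using (gcd)
open import Data.Nat.DivMod using (_/_)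
open import Data.Nat.Properties using (_≟_)
open import Data.List using (List; filter; upTo; map)
open import Data.Nat.ListAction using (product)
open import Relation.Nullary.Decidable using (¬?)
open import Relation.Binary.PropositionalEquality using (_≡_)

divisors : ℕ → List ℕ
divisors m = filter (λ d → d ∣? m) (map suc (upTo m))

T : ℕ → ℕ
T m = product (divisors m)

unitaryDivisors : ℕ → List ℕ
-- (enumerated as suc i for i < m so that the division m / (suc i) is well-defined)
unitaryDivisors m =
  map suc (filter (λ i → suc i ∣? m) (filter (λ i → gcd (suc i) (m / suc i) ≟ 1) (upTo m)))

T* : ℕ → ℕ
T* m = product (unitaryDivisors m)

-- n is K-T₀T*-perfect (K ≥ 2, n > 1 imposed separately)
IsKT0TStarPerfect : ℕ → ℕ → Set
IsKT0TStarPerfect K n = T (T* n) ≡ n ^ K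

-- Pairing each divisor d of m with m / d gives T(m)² = m^τ(m), and likewise T*(m)² = m^τ*(m).
-- Hence T(T*(n))⁴ = n^(τ*(n) τ(T*(n))), so a K-T₀T*-perfect n satisfies 4K = τ*(n) τ(T*(n)).
-- As τ*(n) = 2^ω(n) and K is odd, n has one or two distinct prime factors.
-- For n = p^a this gives T*(n) = n and 4K = 2(a + 1); for n = p^a q^b it gives T*(n) = n²
-- and K = τ(n²) = (2a + 1)(2b + 1).
module Submission where

open import Defs
open import Data.Nat
  using (ℕ; zero; suc; _+_; _*_; _^_; _<_; _≤_; _∸_; _/_; NonZero; z<s; s<s; nonTrivial⇒n>1; ≢-nonZero⁻¹; >-nonZero)
open import Data.Nat.Properties
open import Data.Nat.Divisibility
  using (_∣_; _∣?_; divides; ∣⇒≤; ∣-trans; 0∣⇒≡0; ∣1⇒≡1; _∣0; 1∣_; ∣-refl; ∣m⇒∣m*n; m∣m*n; ∣n⇒∣m*n;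
         *-monoʳ-∣; *-cancelˡ-∣)
open import Data.Nat.DivMod using (m*n/n≡m; m*[n/m]≡n)
open import Data.Nat.GCD using (gcd)
open import Data.Nat.Coprimality using (Coprime; coprime-divisor; coprime⇒gcd≡1; gcd≡1⇒coprime)
import Data.Nat.Coprimality as Coprime
open import Data.Nat.Primality using (Prime; prime⇒irreducible; prime⇒nonZero; prime⇒nonTrivial)
open import Data.Nat.ListAction using (product)
open import Data.Nat.ListAction.Properties using (product-↭)
open import Data.Nat.Induction using (<-rec)
open import Data.Nat.Primality.Factorisation using (factorise)
open import Data.List using (List; []; _∷_; _++_; map; length; upTo)
open import Data.List.Properties using (length-++; length-map)
open import Data.List.Membership.Propositional using (_∈_)
open import Data.List.Membership.Propositional.Properties
  using (∈-map⁺; ∈-map⁻; ∈-filter⁺; ∈-filter⁻; ∈-upTo⁺; ∈-++⁺ˡ; ∈-++⁺ʳ; ∈-++⁻)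
open import Data.List.Membership.Propositional.Properties.WithK using (unique∧set⇒bag)
open import Data.List.Relation.Unary.Any using (here; there)
open import Data.List.Relation.Unary.All as All using ([]; _∷_)
import Data.List.Relation.Unary.All.Properties as All
open import Data.List.Relation.Unary.AllPairs using ([]; _∷_)
open import Data.List.Relation.Unary.Unique.Propositional using (Unique)
import Data.List.Relation.Unary.Unique.Propositional.Properties as Unique
open import Data.List.Relation.Binary.Disjoint.Propositional using (Disjoint)
open import Data.List.Relation.Binary.BagAndSetEquality using (∼bag⇒↭)
open import Data.List.Relation.Binary.Permutation.Propositional using (_↭_)
open import Data.List.Relation.Binary.Permutation.Propositional.Properties using (↭-length)
open import Data.Product using (Σ; _×_; _,_; proj₂; ∃-syntax)
open import Data.Sum using (_⊎_; inj₁; inj₂)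
open import Algebra.Properties.CommutativeSemigroup *-commutativeSemigroup
  using (interchange; x∙yz≈y∙xz; xy∙z≈z∙xy)
open import Function using (it; _∘_; _⇔_; mk⇔)
open import Relation.Binary.Definitions using (tri<; tri≈; tri>)
open import Relation.Nullary using (¬_; Dec; yes; no; contradiction)
open import Relation.Binary.PropositionalEquality
  using (_≡_; _≢_; refl; sym; trans; cong; cong₂; subst; subst₂; module ≡-Reasoning)

unique-⇔⇒↭ : ∀ {xs ys : List ℕ} → Unique xs → Unique ys → (∀ {x} → x ∈ xs ⇔ x ∈ ys) → xs ↭ ys
unique-⇔⇒↭ xs! ys! xs⇔ys = ∼bag⇒↭ (unique∧set⇒bag xs! ys! xs⇔ys)

map⁺-injectiveOn : ∀ {f : ℕ → ℕ} {xs} → (∀ {x y} → x ∈ xs → y ∈ xs → f x ≡ f y → x ≡ y) →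
  Unique xs → Unique (map f xs)
map⁺-injectiveOn {xs = []}     _   []            = []
map⁺-injectiveOn {xs = x ∷ xs} inj (x∉xs ∷ xs!) =
  All.map⁺ (All.tabulate λ y∈xs fx≡fy → All.lookup x∉xs y∈xs (inj (here refl) (there y∈xs) fx≡fy))
  ∷ map⁺-injectiveOn (λ x∈xs y∈xs → inj (there x∈xs) (there y∈xs)) xs!

product-map-* : ∀ (f : ℕ → ℕ) xs → product xs * product (map f xs) ≡ product (map (λ x → x * f x) xs)
product-map-* f []       = refl
product-map-* f (x ∷ xs) = begin
  (x * product xs) * (f x * product (map f xs)) ≡⟨ interchange x (product xs) (f x) (product (map f xs)) ⟩
  (x * f x) * (product xs * product (map f xs)) ≡⟨ cong ((x * f x) *_) (product-map-* f xs) ⟩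
  (x * f x) * product (map (λ x → x * f x) xs)  ∎
  where open ≡-Reasoning

product-map-const : ∀ (f : ℕ → ℕ) m xs → (∀ {x} → x ∈ xs → f x ≡ m) → product (map f xs) ≡ m ^ length xs
product-map-const f m []       _     = refl
product-map-const f m (x ∷ xs) f≡m = cong₂ _*_ (f≡m (here refl)) (product-map-const f m xs (f≡m ∘ there))

record Enumerates (P : ℕ → Set) (xs : List ℕ) : Set where
  field
    unique   : Unique xs
    complete : ∀ {x} → P x → x ∈ xs
    sound    : ∀ {x} → x ∈ xs → P x

length-split : ∀ c .{{_ : NonZero c}} {P Q R : ℕ → Set} {xs ys zs} →
  Enumerates P xs → Enumerates Q ys → Enumerates R zs → (∀ {x} → Q x → ¬ c ∣ x) →
  (∀ {x} → P x → Q x ⊎ ∃[ y ] x ≡ c * y × R y) → (∀ {x} → Q x → P x) → (∀ {y} → R y → P (c * y)) →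
  length xs ≡ length ys + length zs
length-split c {xs = xs} {ys} {zs} P[xs] Q[ys] R[zs] Q⇒c∤ split Q⇒P R⇒P[c*] = begin
  length xs                   ≡⟨ ↭-length (unique-⇔⇒↭ (unique P[xs]) ys++czs! (mk⇔ to from)) ⟩
  length (ys ++ map (c *_) zs) ≡⟨ length-++ ys ⟩
  length ys + length (map (c *_) zs) ≡⟨ cong (length ys +_) (length-map (c *_) zs) ⟩
  length ys + length zs       ∎
  where
  open ≡-Reasoning
  open Enumerates
  disjoint : Disjoint ys (map (c *_) zs)
  disjoint (x∈ys , x∈czs) with _ , _ , refl ← ∈-map⁻ (c *_) x∈czs = Q⇒c∤ (sound Q[ys] x∈ys) (m∣m*n _)
  ys++czs! : Unique (ys ++ map (c *_) zs)
  ys++czs! = Unique.++⁺ (unique Q[ys]) (Unique.map⁺ (*-cancelˡ-≡ _ _ c) (unique R[zs])) disjoint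
  to : ∀ {x} → x ∈ xs → x ∈ ys ++ map (c *_) zs
  to x∈xs with split (sound P[xs] x∈xs)
  ... | inj₁ Qx              = ∈-++⁺ˡ (complete Q[ys] Qx)
  ... | inj₂ (y , refl , Ry) = ∈-++⁺ʳ ys (∈-map⁺ (c *_) (complete R[zs] Ry))
  from : ∀ {x} → x ∈ ys ++ map (c *_) zs → x ∈ xs
  from x∈ with ∈-++⁻ ys x∈
  ... | inj₁ x∈ys = complete P[xs] (Q⇒P (sound Q[ys] x∈ys))
  ... | inj₂ x∈czs with _ , y∈zs , refl ← ∈-map⁻ (c *_) x∈czs = complete P[xs] (R⇒P[c*] (sound R[zs] y∈zs))

coDivisor : ℕ → ℕ → ℕ
coDivisor m zero        = 0
coDivisor m d@(suc _) = m / d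

coDivisor-unique : ∀ {m} d {e} .{{_ : NonZero m}} → d * e ≡ m → coDivisor m d ≡ e
coDivisor-unique {m} zero        0≡m = contradiction (sym 0≡m) (≢-nonZero⁻¹ m)
coDivisor-unique {m} d@(suc _) {e} de≡m = begin
  m / d     ≡⟨ cong (_/ d) (trans (sym de≡m) (*-comm d e)) ⟩
  e * d / d ≡⟨ m*n/n≡m e d ⟩
  e         ∎
  where open ≡-Reasoning

-- Pairing each element with its cofactor: d ↦ m / d permutes the list, as it is an involution on it.
product²≡^length : ∀ m .{{_ : NonZero m}} {P xs} → Enumerates P xs →
  (∀ {x} → P x → P (coDivisor m x)) → (∀ {x} → P x → x * coDivisor m x ≡ m) →
  product xs * product xs ≡ m ^ length xs
product²≡^length m {xs = xs} P[xs] closed paired = begin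
  product xs * product xs             ≡⟨ cong (product xs *_) (product-↭ co[xs]↭xs) ⟨
  product xs * product (map co xs)    ≡⟨ product-map-* co xs ⟩
  product (map (λ x → x * co x) xs)   ≡⟨ product-map-const _ m xs (paired ∘ sound) ⟩
  m ^ length xs                       ∎
  where
  open ≡-Reasoning
  open Enumerates P[xs]
  co = coDivisor m
  co-involutive : ∀ {x} → x ∈ xs → co (co x) ≡ x
  co-involutive {x} x∈xs = coDivisor-unique (co x) (trans (*-comm (co x) x) (paired (sound x∈xs)))
  co-injective : ∀ {x y} → x ∈ xs → y ∈ xs → co x ≡ co y → x ≡ y
  co-injective x∈xs y∈xs cx≡cy =
    trans (sym (co-involutive x∈xs)) (trans (cong co cx≡cy) (co-involutive y∈xs))
  co[xs]↭xs : map co xs ↭ xs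
  co[xs]↭xs = unique-⇔⇒↭ (map⁺-injectiveOn co-injective unique) unique (mk⇔ to from)
    where
    to : ∀ {y} → y ∈ map co xs → y ∈ xs
    to y∈ with x , x∈xs , refl ← ∈-map⁻ co y∈ = complete (closed (sound x∈xs))
    from : ∀ {y} → y ∈ xs → y ∈ map co xs
    from y∈xs = subst (_∈ map co xs) (co-involutive y∈xs) (∈-map⁺ co (complete (closed (sound y∈xs))))

τ : ℕ → ℕ
τ m = length (divisors m)

τ* : ℕ → ℕ
τ* m = length (unitaryDivisors m)

divisors-enumerates : ∀ m .{{_ : NonZero m}} → Enumerates (_∣ m) (divisors m)
divisors-enumerates m = record
  { unique   = Unique.filter⁺ (_∣? m) (Unique.map⁺ suc-injective (Unique.upTo⁺ m))
  ; complete = complete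
  ; sound    = proj₂ ∘ ∈-filter⁻ (_∣? m) {xs = map suc (upTo m)}
  }
  where
  complete : ∀ {d} → d ∣ m → d ∈ divisors m
  complete {zero}  d∣m = contradiction (0∣⇒≡0 d∣m) (≢-nonZero⁻¹ m)
  complete {suc _} d∣m = ∈-filter⁺ (_∣? m) (∈-map⁺ suc (∈-upTo⁺ (∣⇒≤ d∣m))) d∣m

∣⇒*coDivisor≡ : ∀ {m d} .{{_ : NonZero m}} → d ∣ m → d * coDivisor m d ≡ m
∣⇒*coDivisor≡ {m} {d} (divides q m≡qd) =
  trans (cong (d *_) (coDivisor-unique d (sym m≡dq))) (sym m≡dq)
  where m≡dq = trans m≡qd (*-comm q d)

T²≡^τ : ∀ m .{{_ : NonZero m}} → T m * T m ≡ m ^ τ m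
T²≡^τ m = product²≡^length m (divisors-enumerates m)
  (λ {d} d∣m → divides d (sym (∣⇒*coDivisor≡ d∣m))) ∣⇒*coDivisor≡

infix 4 _∥_
_∥_ : ℕ → ℕ → Set
d ∥ m = ∃[ e ] d * e ≡ m × Coprime d e

∥⇒∣ : ∀ {d m} → d ∥ m → d ∣ m
∥⇒∣ {d} (e , de≡m , _) = divides e (sym (trans (*-comm e d) de≡m))

∥-cofactor : ∀ {d e m} → d * e ≡ m → Coprime d e → e ∥ m
∥-cofactor {d} {e} de≡m d⊥e = d , trans (*-comm e d) de≡m , Coprime.sym d⊥e

unitaryDivisors-enumerates : ∀ m .{{_ : NonZero m}} → Enumerates (_∥ m) (unitaryDivisors m)
unitaryDivisors-enumerates m = record
  { unique   = Unique.map⁺ suc-injective (Unique.filter⁺ _ (Unique.filter⁺ _ (Unique.upTo⁺ m)))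
  ; complete = complete
  ; sound    = sound
  }
  where
  complete : ∀ {d} → d ∥ m → d ∈ unitaryDivisors m
  complete {zero}      (e , 0≡m , _) = contradiction (sym 0≡m) (≢-nonZero⁻¹ m)
  complete {d@(suc _)} d∥m@(e , de≡m , coprime) =
    ∈-map⁺ suc (∈-filter⁺ (λ i → suc i ∣? m)
      (∈-filter⁺ (λ i → gcd (suc i) (m / suc i) ≟ 1) (∈-upTo⁺ (∣⇒≤ (∥⇒∣ d∥m))) gcd≡1) (∥⇒∣ d∥m))
    where
    gcd≡1 : gcd d (m / d) ≡ 1
    gcd≡1 = trans (cong (gcd d) (coDivisor-unique d de≡m)) (coprime⇒gcd≡1 coprime)
  sound : ∀ {d} → d ∈ unitaryDivisors m → d ∥ m
  sound d∈ with i , i∈ , refl ← ∈-map⁻ suc d∈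
    with i∈′ , d∣m ← ∈-filter⁻ (λ i → suc i ∣? m) i∈
    with _ , gcd≡1 ← ∈-filter⁻ (λ i → gcd (suc i) (m / suc i) ≟ 1) {xs = upTo m} i∈′
    = m / suc i , m*[n/m]≡n d∣m , gcd≡1⇒coprime gcd≡1

T*²≡^τ* : ∀ m .{{_ : NonZero m}} → T* m * T* m ≡ m ^ τ* m
T*²≡^τ* m = product²≡^length m (unitaryDivisors-enumerates m) closed paired
  where
  closed : ∀ {d} → d ∥ m → coDivisor m d ∥ m
  closed {d} (e , de≡m , coprime) rewrite coDivisor-unique d de≡m = ∥-cofactor de≡m coprime
  paired : ∀ {d} → d ∥ m → d * coDivisor m d ≡ m
  paired {d} (e , de≡m , _) = trans (cong (d *_) (coDivisor-unique d de≡m)) de≡m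

strictlyMonotone⇒injective : ∀ (f : ℕ → ℕ) → (∀ {x y} → x < y → f x < f y) → ∀ {x y} → f x ≡ f y → x ≡ y
strictlyMonotone⇒injective f mono {x} {y} fx≡fy with <-cmp x y
... | tri< x<y _ _ = contradiction fx≡fy (<⇒≢ (mono x<y))
... | tri≈ _ x≡y _ = x≡y
... | tri> _ _ y<x = contradiction (sym fx≡fy) (<⇒≢ (mono y<x))

^-injectiveʳ : ∀ {m} → 1 < m → ∀ {x y} → m ^ x ≡ m ^ y → x ≡ y
^-injectiveʳ {m} 1<m = strictlyMonotone⇒injective (m ^_) (^-monoʳ-< m 1<m)

square-injective : ∀ {x y} → x * x ≡ y * y → x ≡ y
square-injective = strictlyMonotone⇒injective (λ x → x * x) (λ x<y → *-mono-< x<y x<y)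

^-distribʳ-* : ∀ m n o → (m * n) ^ o ≡ m ^ o * n ^ o
^-distribʳ-* m n zero    = refl
^-distribʳ-* m n (suc o) = trans (cong ((m * n) *_) (^-distribʳ-* m n o)) (interchange m n (m ^ o) (n ^ o))

^4≡square² : ∀ x → x ^ 4 ≡ (x * x) * (x * x)
^4≡square² x = trans (cong (λ y → x * (x * (x * y))) (*-identityʳ x)) (sym (*-assoc x x (x * x)))

perfect⇒4k≡τ*·τ∘T* : ∀ k n → 1 < n → IsKT0TStarPerfect k n → 4 * k ≡ τ* n * τ (T* n)
perfect⇒4k≡τ*·τ∘T* k n 1<n perfect = ^-injectiveʳ 1<n (begin
  n ^ (4 * k)                          ≡⟨ cong (n ^_) (*-comm 4 k) ⟩
  n ^ (k * 4)                          ≡⟨ ^-*-assoc n k 4 ⟨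
  (n ^ k) ^ 4                          ≡⟨ ^4≡square² (n ^ k) ⟩
  (n ^ k * n ^ k) * (n ^ k * n ^ k)    ≡⟨ cong (λ x → (x * x) * (x * x)) perfect ⟨
  (T M * T M) * (T M * T M)            ≡⟨ cong₂ _*_ (T²≡^τ M) (T²≡^τ M) ⟩
  M ^ τ M * M ^ τ M                    ≡⟨ ^-distribʳ-* M M (τ M) ⟨
  (M * M) ^ τ M                        ≡⟨ cong (_^ τ M) (T*²≡^τ* n) ⟩
  (n ^ τ* n) ^ τ M                     ≡⟨ ^-*-assoc n (τ* n) (τ M) ⟩
  n ^ (τ* n * τ M)                     ∎)
  where
  open ≡-Reasoning
  M = T* n
  instance
    n≢0 : NonZero n
    n≢0 = >-nonZero (<-trans z<s 1<n)
    M≢0 : NonZero M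
    M≢0 = m*n≢0⇒m≢0 M {{subst NonZero (sym (T*²≡^τ* n)) (m^n≢0 n (τ* n))}}

prime⇒>1 : ∀ {p} → Prime p → 1 < p
prime⇒>1 {p} p-prime = nonTrivial⇒n>1 p {{prime⇒nonTrivial p-prime}}

∤⇒nonZero : ∀ {p m} → ¬ p ∣ m → NonZero m
∤⇒nonZero {p} {zero}  p∤0 = contradiction (p ∣0) p∤0
∤⇒nonZero {p} {suc _} _   = _

coprime-∣ˡ : ∀ {d m n} → d ∣ m → Coprime m n → Coprime d n
coprime-∣ˡ d∣m m⊥n (i∣d , i∣n) = m⊥n (∣-trans i∣d d∣m , i∣n)

coprime-*ʳ : ∀ {m n o} → Coprime m n → Coprime m o → Coprime m (n * o)
coprime-*ʳ m⊥n m⊥o (i∣m , i∣no) = m⊥o (i∣m , coprime-divisor (coprime-∣ˡ i∣m m⊥n) i∣no)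

∤⇒coprime-^ : ∀ {p m} → Prime p → ¬ p ∣ m → ∀ a → Coprime m (p ^ a)
∤⇒coprime-^         p-prime p∤m zero    (_ , i∣1) = ∣1⇒≡1 i∣1
∤⇒coprime-^ {p} {m} p-prime p∤m (suc a) = coprime-*ʳ m⊥p (∤⇒coprime-^ p-prime p∤m a)
  where
  m⊥p : Coprime m p
  m⊥p (i∣m , i∣p) with prime⇒irreducible p-prime i∣p
  ... | inj₁ i≡1  = i≡1
  ... | inj₂ refl = contradiction i∣m p∤m

prime∤1 : ∀ {p} → Prime p → ¬ p ∣ 1
prime∤1 p-prime p∣1 = >⇒≢ (prime⇒>1 p-prime) (∣1⇒≡1 p∣1)

prime∤prime^ : ∀ {p q} → Prime p → Prime q → p ≢ q → ∀ j → ¬ p ∣ q ^ j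
prime∤prime^ {p} {q} p-prime q-prime p≢q j p∣q^j =
  <⇒≢ (prime⇒>1 p-prime) (sym (∤⇒coprime-^ q-prime q∤p j (∣-refl , p∣q^j)))
  where
  q∤p : ¬ q ∣ p
  q∤p q∣p with prime⇒irreducible p-prime q∣p
  ... | inj₁ q≡1 = <⇒≢ (prime⇒>1 q-prime) (sym q≡1)
  ... | inj₂ q≡p = p≢q (sym q≡p)

∣-split-prime^ : ∀ {p m d} → Prime p → ¬ p ∣ m → ∀ a →
  d ∣ p ^ suc a * m → d ∣ m ⊎ ∃[ d′ ] d ≡ p * d′ × d′ ∣ p ^ a * m
∣-split-prime^ {p} {m} {d} p-prime p∤m a d∣ with p ∣? d
... | no p∤d = inj₁ (coprime-divisor (∤⇒coprime-^ p-prime p∤d (suc a)) d∣)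
... | yes (divides d′ refl) = inj₂ (d′ , *-comm d′ p , *-cancelˡ-∣ p {{prime⇒nonZero p-prime}} pd′∣)
  where
  pd′∣ : p * d′ ∣ p * (p ^ a * m)
  pd′∣ = subst₂ _∣_ (*-comm d′ p) (*-assoc p (p ^ a) m) d∣

τ-prime^-step : ∀ {p m} → Prime p → ¬ p ∣ m → ∀ a → τ (p ^ suc a * m) ≡ τ m + τ (p ^ a * m)
τ-prime^-step {p} {m} p-prime p∤m a =
  length-split p
    (divisors-enumerates (p ^ suc a * m)) (divisors-enumerates m) (divisors-enumerates (p ^ a * m))
    (λ d∣m p∣d → p∤m (∣-trans p∣d d∣m)) (∣-split-prime^ p-prime p∤m a) (∣n⇒∣m*n (p ^ suc a))
    (λ {d} d∣ → subst (p * d ∣_) (sym (*-assoc p (p ^ a) m)) (*-monoʳ-∣ p d∣))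
  where
  instance
    p≢0 = prime⇒nonZero p-prime
    m≢0 = ∤⇒nonZero p∤m
    p^a*m≢0 : NonZero (p ^ a * m)
    p^a*m≢0 = m*n≢0 (p ^ a) m {{m^n≢0 p a}}
    p^[1+a]*m≢0 : NonZero (p ^ suc a * m)
    p^[1+a]*m≢0 = m*n≢0 (p ^ suc a) m {{m^n≢0 p (suc a)}}

τ[prime^*m] : ∀ {p m} → Prime p → ¬ p ∣ m → ∀ a → τ (p ^ a * m) ≡ suc a * τ m
τ[prime^*m] {m = m} p-prime p∤m zero    = trans (cong τ (*-identityˡ m)) (sym (+-identityʳ (τ m)))
τ[prime^*m] {m = m} p-prime p∤m (suc a) =
  trans (τ-prime^-step p-prime p∤m a) (cong (τ m +_) (τ[prime^*m] p-prime p∤m a))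

coprime-∣ʳ : ∀ {d m n} → d ∣ n → Coprime m n → Coprime m d
coprime-∣ʳ d∣n m⊥n = Coprime.sym (coprime-∣ˡ d∣n (Coprime.sym m⊥n))

coprime-cofactor : ∀ {x e c m} .{{_ : NonZero x}} → Coprime x c → x * e ≡ c * m →
  ∃[ q ] x * q ≡ m × e ≡ c * q
coprime-cofactor {x} {e} {c} {m} x⊥c xe≡cm
  with divides q m≡qx ← coprime-divisor x⊥c (divides e (sym (trans (*-comm e x) xe≡cm))) =
  q , sym (trans m≡qx (*-comm q x)) , *-cancelˡ-≡ e (c * q) x (begin
    x * e       ≡⟨ xe≡cm ⟩
    c * m       ≡⟨ cong (c *_) (trans m≡qx (*-comm q x)) ⟩
    c * (x * q) ≡⟨ x∙yz≈y∙xz c x q ⟩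
    x * (c * q) ∎)
  where open ≡-Reasoning

∥-split-prime^ : ∀ {p m d} → Prime p → ¬ p ∣ m → ∀ a →
  d ∥ p ^ suc a * m → d ∥ m ⊎ ∃[ d′ ] d ≡ p ^ suc a * d′ × d′ ∥ m
∥-split-prime^ {p} {m} {d} p-prime p∤m a (e , de≡Am , d⊥e) = split (p ∣? d)
  where
  A = p ^ suc a
  instance
    de≢0 : NonZero (d * e)
    de≢0 = subst NonZero (sym de≡Am)
      (m*n≢0 A m {{m^n≢0 p (suc a) {{prime⇒nonZero p-prime}}}} {{∤⇒nonZero p∤m}})
  p∤e : p ∣ d → ¬ p ∣ e
  p∤e p∣d p∣e = <⇒≢ (prime⇒>1 p-prime) (sym (d⊥e (p∣d , p∣e)))
  split : Dec (p ∣ d) → d ∥ m ⊎ ∃[ d′ ] d ≡ A * d′ × d′ ∥ m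
  split (no p∤d)
    with q , dq≡m , e≡Aq ← coprime-cofactor {{m*n≢0⇒m≢0 d}} (∤⇒coprime-^ p-prime p∤d (suc a)) de≡Am =
    inj₁ (q , dq≡m , coprime-∣ʳ (divides A e≡Aq) d⊥e)
  split (yes p∣d)
    with q , eq≡m , d≡Aq ← coprime-cofactor {{m*n≢0⇒n≢0 d}} (∤⇒coprime-^ p-prime (p∤e p∣d) (suc a))
                                            (trans (*-comm e d) de≡Am) =
    inj₂ (q , d≡Aq , e , trans (*-comm q e) eq≡m , coprime-∣ˡ (divides A d≡Aq) d⊥e)

τ*[prime^*m] : ∀ {p m} → Prime p → ¬ p ∣ m → ∀ a → τ* (p ^ suc a * m) ≡ 2 * τ* m
τ*[prime^*m] {p} {m} p-prime p∤m a = trans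
  (length-split A
    (unitaryDivisors-enumerates (A * m)) (unitaryDivisors-enumerates m) (unitaryDivisors-enumerates m)
    (λ d∥m A∣d → p∤ d∥m (∣-trans (m∣m*n (p ^ a)) A∣d)) (∥-split-prime^ p-prime p∤m a) ∥m⇒∥Am A*∥m⇒∥Am)
  (cong (τ* m +_) (sym (+-identityʳ (τ* m))))
  where
  A = p ^ suc a
  instance
    m≢0 = ∤⇒nonZero p∤m
    A≢0 = m^n≢0 p (suc a) {{prime⇒nonZero p-prime}}
    Am≢0 : NonZero (A * m)
    Am≢0 = m*n≢0 A m
  p∤ : ∀ {d} → d ∥ m → ¬ p ∣ d
  p∤ d∥m p∣d = p∤m (∣-trans p∣d (∥⇒∣ d∥m))
  ∥m⇒∥Am : ∀ {d} → d ∥ m → d ∥ A * m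
  ∥m⇒∥Am {d} d∥m@(e , de≡m , d⊥e) =
    A * e , trans (x∙yz≈y∙xz d A e) (cong (A *_) de≡m) , coprime-*ʳ (∤⇒coprime-^ p-prime (p∤ d∥m) (suc a)) d⊥e
  A*∥m⇒∥Am : ∀ {d} → d ∥ m → A * d ∥ A * m
  A*∥m⇒∥Am {d} (e , de≡m , d⊥e) =
    e , trans (*-assoc A d e) (cong (A *_) de≡m) ,
    Coprime.sym (coprime-*ʳ (∤⇒coprime-^ p-prime (p∤ (∥-cofactor de≡m d⊥e)) (suc a)) (Coprime.sym d⊥e))

τ[prime^] : ∀ {p} → Prime p → ∀ a → τ (p ^ a) ≡ suc a
τ[prime^] {p} p-prime a = begin
  τ (p ^ a)      ≡⟨ cong τ (*-identityʳ (p ^ a)) ⟨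
  τ (p ^ a * 1)  ≡⟨ τ[prime^*m] p-prime (prime∤1 p-prime) a ⟩
  suc a * 1      ≡⟨ *-identityʳ (suc a) ⟩
  suc a          ∎
  where open ≡-Reasoning

τ*[prime^] : ∀ {p} → Prime p → ∀ a → τ* (p ^ suc a) ≡ 2
τ*[prime^] {p} p-prime a =
  trans (cong τ* (sym (*-identityʳ (p ^ suc a)))) (τ*[prime^*m] p-prime (prime∤1 p-prime) a)

τ[prime^*prime^] : ∀ {p q} → Prime p → Prime q → p ≢ q → ∀ i j → τ (p ^ i * q ^ j) ≡ suc i * suc j
τ[prime^*prime^] p-prime q-prime p≢q i j =
  trans (τ[prime^*m] p-prime (prime∤prime^ p-prime q-prime p≢q j) i) (cong (suc i *_) (τ[prime^] q-prime j))

prime-divisor : ∀ {n} → 1 < n → ∃[ p ] Prime p × p ∣ n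
prime-divisor {n} 1<n with factorise n {{>-nonZero (<-trans z<s 1<n)}}
... | record { factors = [] ; isFactorisation = n≡1 } = contradiction n≡1 (>⇒≢ 1<n)
... | record { factors = p ∷ ps ; isFactorisation = n≡∏ ; factorsPrime = p-prime ∷ _ } =
  p , p-prime , subst (p ∣_) (sym n≡∏) (m∣m*n (product ps))

prime^-cofactor : ∀ {p} → Prime p → ∀ n → .{{_ : NonZero n}} → ∃[ a ] ∃[ m ] ¬ p ∣ m × n ≡ p ^ a * m
prime^-cofactor {p} p-prime n = <-rec P step n
  where
  P : ℕ → Set
  P n = .{{_ : NonZero n}} → ∃[ a ] ∃[ m ] ¬ p ∣ m × n ≡ p ^ a * m
  step : ∀ n → (∀ {q} → q < n → P q) → P n
  step n rec with p ∣? n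
  ... | no p∤n = 0 , n , p∤n , sym (*-identityˡ n)
  ... | yes (divides q n≡qp) = absorb-p (rec q<n {{q≢0}})
    where
    q≢0 : NonZero q
    q≢0 = m*n≢0⇒m≢0 q {{subst NonZero n≡qp it}}
    q<n : q < n
    q<n = subst (q <_) (sym n≡qp) (m<m*n q p {{q≢0}} (prime⇒>1 p-prime))
    absorb-p : ∃[ a ] ∃[ m ] ¬ p ∣ m × q ≡ p ^ a * m → ∃[ a ] ∃[ m ] ¬ p ∣ m × n ≡ p ^ a * m
    absorb-p (a , m , p∤m , q≡p^a*m) = suc a , m , p∤m , (begin
      n               ≡⟨ n≡qp ⟩
      q * p           ≡⟨ cong (_* p) q≡p^a*m ⟩
      p ^ a * m * p   ≡⟨ xy∙z≈z∙xy (p ^ a) m p ⟩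
      p * (p ^ a * m) ≡⟨ *-assoc p (p ^ a) m ⟨
      p ^ suc a * m   ∎)
      where open ≡-Reasoning

prime^-split : ∀ {n} → 1 < n → ∃[ p ] ∃[ a ] ∃[ m ] Prime p × ¬ p ∣ m × n ≡ p ^ suc a * m
prime^-split {n} 1<n with p , p-prime , p∣n ← prime-divisor 1<n
  with prime^-cofactor p-prime n {{>-nonZero (<-trans z<s 1<n)}}
... | zero  , m , p∤m , n≡1*m = contradiction (subst (p ∣_) (trans n≡1*m (*-identityˡ m)) p∣n) p∤m
... | suc a , m , p∤m , n≡p^[1+a]*m = p , a , m , p-prime , p∤m , n≡p^[1+a]*m

≡1⊎>1 : ∀ {m} → NonZero m → m ≡ 1 ⊎ 1 < m
≡1⊎>1 {suc zero}    _ = inj₁ refl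
≡1⊎>1 {suc (suc _)} _ = inj₂ (s<s z<s)

-- n has one, two, or at least three distinct prime factors; the last case is recorded as
-- 8 ∣ τ*(n) = 2^ω(n), which is all that is needed to rule it out.
data UnitaryShape (n : ℕ) : Set where
  prime^         : ∀ {p a} → Prime p → n ≡ p ^ suc a → UnitaryShape n
  prime^*prime^  : ∀ {p q a b} → Prime p → Prime q → p ≢ q → n ≡ p ^ suc a * q ^ suc b → UnitaryShape n
  8∣τ*           : 8 ∣ τ* n → UnitaryShape n

unitaryShape : ∀ {n} → 1 < n → UnitaryShape n
unitaryShape 1<n with p , a , m , p-prime , p∤m , refl ← prime^-split 1<n with ≡1⊎>1 (∤⇒nonZero p∤m)
... | inj₁ refl = prime^ {a = a} p-prime (*-identityʳ _)
... | inj₂ 1<m with q , b , m′ , q-prime , q∤m′ , refl ← prime^-split 1<m with ≡1⊎>1 (∤⇒nonZero q∤m′)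
...   | inj₁ refl = prime^*prime^ {a = a} {b} p-prime q-prime p≢q (cong (p ^ suc a *_) (*-identityʳ _))
  where
  p≢q : p ≢ q
  p≢q refl = p∤m (∣-trans (m∣m*n (p ^ b)) (m∣m*n 1))
...   | inj₂ 1<m′ with r , c , m″ , r-prime , r∤m″ , refl ← prime^-split 1<m′ =
  8∣τ* (subst (8 ∣_) (sym τ*≡) (*-monoʳ-∣ 2 (*-monoʳ-∣ 2 (*-monoʳ-∣ 2 (1∣ τ* m″)))))
  where
  τ*≡ : τ* (p ^ suc a * (q ^ suc b * (r ^ suc c * m″))) ≡ 2 * (2 * (2 * τ* m″))
  τ*≡ = trans (τ*[prime^*m] p-prime p∤m a)
          (cong (2 *_) (trans (τ*[prime^*m] q-prime q∤m′ b) (cong (2 *_) (τ*[prime^*m] r-prime r∤m″ c))))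

T*≡^ : ∀ n j .{{_ : NonZero n}} → τ* n ≡ 2 * j → T* n ≡ n ^ j
T*≡^ n j τ*≡2j = square-injective (begin
  T* n * T* n   ≡⟨ T*²≡^τ* n ⟩
  n ^ τ* n      ≡⟨ cong (n ^_) (trans τ*≡2j (cong (j +_) (+-identityʳ j))) ⟩
  n ^ (j + j)   ≡⟨ ^-distribˡ-+-* n j j ⟩
  n ^ j * n ^ j ∎)
  where open ≡-Reasoning

prime^-exponent : ∀ {k p a} → Prime p → IsKT0TStarPerfect k (p ^ suc a) → 2 * k ∸ 1 ≡ suc a
prime^-exponent {k} {p} {a} p-prime perfect = cong (_∸ 1) (*-cancelˡ-≡ (2 * k) (suc (suc a)) 2 (begin
  2 * (2 * k)      ≡⟨ *-assoc 2 2 k ⟨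
  4 * k            ≡⟨ perfect⇒4k≡τ*·τ∘T* k n 1<n perfect ⟩
  τ* n * τ (T* n)  ≡⟨ cong₂ _*_ (τ*[prime^] p-prime a) (cong τ T*n≡n) ⟩
  2 * τ n          ≡⟨ cong (2 *_) (τ[prime^] p-prime (suc a)) ⟩
  2 * suc (suc a)  ∎))
  where
  open ≡-Reasoning
  n = p ^ suc a
  instance
    n≢0 = m^n≢0 p (suc a) {{prime⇒nonZero p-prime}}
  1<n : 1 < n
  1<n = ^-monoʳ-< p (prime⇒>1 p-prime) (z<s {a})
  T*n≡n : T* n ≡ n
  T*n≡n = trans (T*≡^ n 1 (τ*[prime^] p-prime a)) (^-identityʳ n)

prime^*prime^-exponents : ∀ {k p q a b} → Prime p → Prime q → p ≢ q →
  IsKT0TStarPerfect k (p ^ suc a * q ^ suc b) → k ≡ suc (suc a * 2) * suc (suc b * 2)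
prime^*prime^-exponents {k} {p} {q} {a} {b} p-prime q-prime p≢q perfect = *-cancelˡ-≡ k _ 4 (begin
  4 * k                                     ≡⟨ perfect⇒4k≡τ*·τ∘T* k n 1<n perfect ⟩
  τ* n * τ (T* n)                           ≡⟨ cong₂ _*_ τ*n≡4 (cong τ T*n≡) ⟩
  4 * τ (p ^ (suc a * 2) * q ^ (suc b * 2))
    ≡⟨ cong (4 *_) (τ[prime^*prime^] p-prime q-prime p≢q (suc a * 2) (suc b * 2)) ⟩
  4 * (suc (suc a * 2) * suc (suc b * 2))   ∎)
  where
  open ≡-Reasoning
  P = p ^ suc a
  Q = q ^ suc b
  n = P * Q
  instance
    Q≢0 = m^n≢0 q (suc b) {{prime⇒nonZero q-prime}}
    n≢0 = m*n≢0 P Q {{m^n≢0 p (suc a) {{prime⇒nonZero p-prime}}}}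
  1<n : 1 < n
  1<n = <-≤-trans (^-monoʳ-< p (prime⇒>1 p-prime) (z<s {a})) (m≤m*n P Q)
  τ*n≡4 : τ* n ≡ 2 * 2
  τ*n≡4 = trans (τ*[prime^*m] p-prime (prime∤prime^ p-prime q-prime p≢q (suc b)) a)
                (cong (2 *_) (τ*[prime^] q-prime b))
  T*n≡ : T* n ≡ p ^ (suc a * 2) * q ^ (suc b * 2)
  T*n≡ = begin
    T* n        ≡⟨ T*≡^ n 2 τ*n≡4 ⟩
    (P * Q) ^ 2 ≡⟨ ^-distribʳ-* P Q 2 ⟩
    P ^ 2 * Q ^ 2 ≡⟨ cong₂ _*_ (^-*-assoc p (suc a) 2) (^-*-assoc q (suc b) 2) ⟩
    p ^ (suc a * 2) * q ^ (suc b * 2) ∎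

[odd∸1]/2≡ : ∀ a → (suc (a * 2) ∸ 1) / 2 ≡ a
[odd∸1]/2≡ a = m*n/n≡m a 2

-- The hypotheses k ≥ 2 and "k not prime" are not needed: in the second case both d and k / d are
-- odd numbers at least 3.
theorem3p7 : (k : ℕ) → 2 ≤ k → ¬ (2 ∣ k) → ¬ Prime k →
    (n : ℕ) → 1 < n → IsKT0TStarPerfect k n →
    (∃[ p₁ ] (Prime p₁ × n ≡ p₁ ^ (2 * k ∸ 1)))
    ⊎ (∃[ p₁ ] ∃[ p₂ ] ∃[ d ] Σ (NonZero d) λ nz →
         Prime p₁ × Prime p₂ × p₁ ≢ p₂ × d ∣ k × 2 < d × d < k ×
         n ≡ p₁ ^ ((d ∸ 1) / 2) * p₂ ^ (((k / d) {{nz}} ∸ 1) / 2))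
theorem3p7 k _ 2∤k _ n 1<n perfect with unitaryShape 1<n
... | prime^ {p} {a} p-prime refl =
  inj₁ (p , p-prime , cong (p ^_) (sym (prime^-exponent {k} {a = a} p-prime perfect)))
... | prime^*prime^ {p} {q} {a} {b} p-prime q-prime p≢q refl =
  inj₂ (p , q , d , _ , p-prime , q-prime , p≢q , subst (d ∣_) (sym k≡de) (divides e (*-comm d e)) ,
        s<s (s<s z<s) , subst (d <_) (sym k≡de) (m<m*n d e (s<s z<s)) , n≡)
  where
  d = suc (suc a * 2)
  e = suc (suc b * 2)
  k≡de : k ≡ d * e
  k≡de = prime^*prime^-exponents {k} {a = a} {b} p-prime q-prime p≢q perfect
  k/d≡e : k / d ≡ e
  k/d≡e = trans (cong (_/ d) (trans k≡de (*-comm d e))) (m*n/n≡m e d)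
  n≡ : p ^ suc a * q ^ suc b ≡ p ^ ((d ∸ 1) / 2) * q ^ ((k / d ∸ 1) / 2)
  n≡ = cong₂ (λ i j → p ^ i * q ^ j)
         (sym ([odd∸1]/2≡ (suc a))) (sym (trans (cong (λ x → (x ∸ 1) / 2) k/d≡e) ([odd∸1]/2≡ (suc b))))
... | 8∣τ* 8∣τ*n = contradiction (*-cancelˡ-∣ 4 8∣4k) 2∤k
  where
  8∣4k : 8 ∣ 4 * k
  8∣4k = subst (8 ∣_) (sym (perfect⇒4k≡τ*·τ∘T* k n 1<n perfect)) (∣m⇒∣m*n _ 8∣τ*n)
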